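{- Let $a,b$ be positive integers, $A=(a,a)$, $B=(b,b)$, and let $(S(i))_{i\ge0}$ be the ordered Markov sequences for $A$ and $B$. Let $k$ be a positive odd integer, set $k_1=k$, and suppose $i\ge2$ is an integer such that the numbers $k_j=\frac{k_{j-1}+1}{2}$, $j=2,\ldots,i$, are positive integers with $k_i$ even. Let $k_{i+1}=k_i/2$. Then \[ \frac{|S(k_{i+1})|}{2}=d_{k-1}, \] where $|X|$ is the length of $X$ and $d_n$ is Stern's diatomic sequence.
   Context: For finite sequences $X,Y$, $X\oplus Y$ denotes concatenation. For a triple $(X,Y,Z)$ of finite sequences put $\mathcal{L}(X,Y,Z)=(X,X\oplus Y,Y)$ and $\mathcal{R}(X,Y,Z)=(Y,Y\oplus Z,Z)$. Let $v=(A,A\oplus B,B)$. For $m\ge1$ the $2^m$ triples at depth $m$ are $\varepsilon_m(\cdots\varepsilon_1(v)\cdots)$ for words $(\varepsilon_1,\ldots,\varepsilon_m)\in\{\mathcal{L},\mathcal{R}\}^m$ ($\varepsilon_1$ applied first), listed in lexicographic order with $\mathcal{L}<\mathcal{R}$. The ordered Markov sequences are $S(0)=A$, $S(1)=B$, $S(2)=A\oplus B$, and for $m\ge1$, $1\le i\le2^m$, $S(2^m+i)$ is the middle component of the $i$-th triple at depth $m$. Stern's diatomic sequence: $d_0=0$, $d_1=1$, $d_{2n}=d_n$, $d_{2n-1}=d_n+d_{n-1}$ for $n\ge1$. -}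

module Defs where

open import Data.Nat using (ℕ; zero; suc; _+_; _*_; _∸_; _^_; _%_; _/_)
open import Data.List using (List; []; _∷_; _++_; map; concat; length)
open import Data.Product using (_×_; _,_)
open import Data.Bool using (if_then_else_)
open import Data.Nat using (_≡ᵇ_)

Triple : Set
Triple = List ℕ × List ℕ × List ℕ

data Dir : Set where
  L R : Dir

step : Dir → Triple → Triple
step L (X , Y , Z) = (X , X ++ Y , Y)
step R (X , Y , Z) = (Y , Y ++ Z , Z)

applyWord : List Dir → Triple → Triple
applyWord []      t = t
applyWord (e ∷ w) t = applyWord w (step e t)

words : ℕ → List (List Dir)
words zero    = [] ∷ []
words (suc m) = map (L ∷_) (words m) ++ map (R ∷_) (words m)

middle : Triple → List ℕ
middle (_ , Y , _) = Y

middlesAt : Triple → ℕ → List (List ℕ)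
middlesAt v m = map (λ w → middle (applyWord w v)) (words m)

middlesUpTo : Triple → ℕ → List (List ℕ)
middlesUpTo v zero    = []
middlesUpTo v (suc m) = middlesUpTo v m ++ middlesAt v (suc m)

-- Lookup with a default (the default is never used below since the list is long enough).
lookupD : {X : Set} → X → List X → ℕ → X
lookupD x []       n       = x
lookupD x (y ∷ ys) zero    = y
lookupD x (y ∷ ys) (suc n) = lookupD x ys n

-- Ordered Markov sequences: S(0)=A, S(1)=B, S(2)=A⊕B, and S(2^m+i) is the
-- middle component of the i-th triple at depth m (1 ≤ i ≤ 2^m).
-- The list A ∷ B ∷ A⊕B ∷ (depth 1) ++ (depth 2) ++ … lists S(0),S(1),S(2),… in order;
-- depths up to n suffice to contain index n.
S : List ℕ → List ℕ → ℕ → List ℕ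
S A B n = lookupD [] (A ∷ B ∷ (A ++ B) ∷ middlesUpTo (A , A ++ B , B) n) n

-- Stern's diatomic sequence: d 0 = 0, d 1 = 1, d (2n) = d n, d (2n-1) = d n + d (n-1).
-- Defined by recursion on fuel; fuel n+1 suffices for argument n.
sternF : ℕ → ℕ → ℕ
sternF _ zero = 0
sternF _ (suc zero) = 1
sternF zero (suc (suc n)) = 0
sternF (suc f) (suc (suc n)) =
  if (n % 2) ≡ᵇ 0
  then sternF f ((n + 2) / 2)
  else sternF f ((n + 3) / 2) + sternF f ((n + 1) / 2)

d : ℕ → ℕ
d n = sternF (suc n) n

{-# OPTIONS --safe #-}
module Submission where

-- The lengths in a Markov triple evolve like pairs of consecutive Stern numbers:
-- a triple with lengths (u, u + v, v) has children (u, 2u + v, u + v) and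
-- (u + v, u + 2v, v), exactly as (d N, d (N + 1)) has children (d (2N), d (2N + 1))
-- and (d (2N + 1), d (2N + 2)).  Tracking positions in the enumeration gives
-- |S(n)| = c · d (2n − 1) when |A| = |B| = c.  On the other hand k ↦ (k + 1)/2
-- halves k − 1, so d (k − 1) is preserved along k₁, …, kᵢ, and kᵢ − 1 = 2kᵢ₊₁ − 1.

open import Defs
open import Data.Nat using (ℕ; zero; suc; _+_; _*_; _∸_; _%_; _/_; _^_; _≤_; _<_; z≤n; s≤s; _≡ᵇ_)
open import Data.Bool using (if_then_else_)
open import Data.Nat.Properties
open import Data.Nat.DivMod using (m*n%n≡0; [m+kn]%n≡m%n; m*n/n≡m; m<n*o⇒m/o<n)
open import Data.List using (List; []; _∷_; _++_; map; length)
open import Data.List.Properties using (length-++; length-map; map-++; map-∘)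
open import Data.Product using (_×_; _,_; proj₁; proj₂)
open import Function using (_∘_)
open import Data.Unit using (⊤; tt)
open import Data.Empty using (⊥-elim)
open import Relation.Binary.PropositionalEquality

halve-< : ∀ m {c} → c ≤ 3 → (m + c) / 2 < 2 + m
halve-< m {c} c≤3 = m<n*o⇒m/o<n (begin-strict
  m + c  ≤⟨ +-monoʳ-≤ m c≤3 ⟩
  m + 3  ≡⟨ +-comm m 3 ⟩
  3 + m  <⟨ s≤s (s≤s (s≤s (s≤s (m≤m*n m 2)))) ⟩
  (2 + m) * 2 ∎)
  where open ≤-Reasoning

sternF-fuel-irrelevant : ∀ {f g} n → n < f → n < g → sternF f n ≡ sternF g n
sternF-fuel-irrelevant zero _ _ = refl
sternF-fuel-irrelevant (suc zero) _ _ = refl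
sternF-fuel-irrelevant {suc f} {suc g} (suc (suc m)) (s≤s m<f) (s≤s m<g) =
  cong₂ (λ x y → if m % 2 ≡ᵇ 0 then x else y)
        (recurse 2 (s≤s (s≤s z≤n)))
        (cong₂ _+_ (recurse 3 ≤-refl) (recurse 1 (s≤s z≤n)))
  where
  recurse : ∀ c → c ≤ 3 → sternF f ((m + c) / 2) ≡ sternF g ((m + c) / 2)
  recurse c c≤3 = sternF-fuel-irrelevant _ (<-≤-trans (halve-< m c≤3) m<f) (<-≤-trans (halve-< m c≤3) m<g)

sternF≡d : ∀ {f n} → n < f → sternF f n ≡ d n
sternF≡d {n = n} n<f = sternF-fuel-irrelevant n n<f (n<1+n n)

sternF-even-step : ∀ f m → m % 2 ≡ 0 →
  sternF (suc f) (2 + m) ≡ sternF f ((m + 2) / 2)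
sternF-even-step f m even =
  cong (λ b → if b then sternF f ((m + 2) / 2) else sternF f ((m + 3) / 2) + sternF f ((m + 1) / 2))
       (cong (_≡ᵇ 0) even)

sternF-odd-step : ∀ f m → m % 2 ≡ 1 →
  sternF (suc f) (2 + m) ≡ sternF f ((m + 3) / 2) + sternF f ((m + 1) / 2)
sternF-odd-step f m odd =
  cong (λ b → if b then sternF f ((m + 2) / 2) else sternF f ((m + 3) / 2) + sternF f ((m + 1) / 2))
       (cong (_≡ᵇ 0) odd)

sternF-halve : ∀ {f} m c n → c + m ≡ n * 2 → n < f → sternF f ((m + c) / 2) ≡ d n
sternF-halve {f} m c n c+m≡2n n<f = begin
  sternF f ((m + c) / 2)  ≡⟨ cong (λ x → sternF f (x / 2)) (trans (+-comm m c) c+m≡2n) ⟩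
  sternF f (n * 2 / 2)    ≡⟨ cong (sternF f) (m*n/n≡m n 2) ⟩
  sternF f n              ≡⟨ sternF≡d n<f ⟩
  d n                     ∎
  where open ≡-Reasoning

d-double : ∀ n → d (n * 2) ≡ d n
d-double zero    = refl
d-double (suc n) = trans (sternF-even-step _ (n * 2) (m*n%n≡0 n 2))
                         (sternF-halve (n * 2) 2 (suc n) refl (s≤s (s≤s (m≤m*n n 2))))

d-double+1 : ∀ n → d (suc (n * 2)) ≡ d n + d (suc n)
d-double+1 zero    = refl
d-double+1 (suc n) = begin
  d (2 + suc (n * 2))
    ≡⟨ sternF-odd-step _ (suc (n * 2)) ([m+kn]%n≡m%n 1 n 2) ⟩
  sternF _ ((suc (n * 2) + 3) / 2) + sternF _ ((suc (n * 2) + 1) / 2)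
    ≡⟨ cong₂ _+_ (sternF-halve (suc (n * 2)) 3 (2 + n) refl (s≤s (s≤s (s≤s n≤2n))))
                 (sternF-halve (suc (n * 2)) 1 (suc n) refl (s≤s (s≤s (m≤n⇒m≤1+n n≤2n)))) ⟩
  d (2 + n) + d (suc n)
    ≡⟨ +-comm (d (2 + n)) (d (suc n)) ⟩
  d (suc n) + d (2 + n) ∎
  where
  open ≡-Reasoning
  n≤2n : n ≤ n * 2
  n≤2n = m≤m*n n 2

d-even : ∀ n → d (2 * n) ≡ d n
d-even n = trans (cong d (*-comm 2 n)) (d-double n)

d-odd : ∀ n → d (suc (2 * n)) ≡ d n + d (suc n)
d-odd n = trans (cong (λ m → d (suc m)) (*-comm 2 n)) (d-double+1 n)

Shaped : ℕ → ℕ → Triple → Set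
Shaped u v (x , y , z) = length x ≡ u × length y ≡ u + v × length z ≡ v

step-L-shaped : ∀ {u v} t → Shaped u v t → Shaped u (u + v) (step L t)
step-L-shaped (x , y , z) (∣x∣ , ∣y∣ , _) = ∣x∣ , trans (length-++ x) (cong₂ _+_ ∣x∣ ∣y∣) , ∣y∣

step-R-shaped : ∀ {u v} t → Shaped u v t → Shaped (u + v) v (step R t)
step-R-shaped (x , y , z) (_ , ∣y∣ , ∣z∣) = ∣y∣ , trans (length-++ y) (cong₂ _+_ ∣y∣ ∣z∣) , ∣z∣

SternShaped : ℕ → ℕ → Triple → Set
SternShaped c N = Shaped (c * d N) (c * d (suc N))

c*d-odd : ∀ c n → c * d (suc (2 * n)) ≡ c * d n + c * d (suc n)
c*d-odd c n = trans (cong (c *_) (d-odd n)) (*-distribˡ-+ c (d n) (d (suc n)))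

step-L-sternShaped : ∀ c N t → SternShaped c N t → SternShaped c (2 * N) (step L t)
step-L-sternShaped c N t s =
  subst₂ (λ u v → Shaped u v (step L t))
         (cong (c *_) (sym (d-even N))) (sym (c*d-odd c N))
         (step-L-shaped t s)

step-R-sternShaped : ∀ c N t → SternShaped c N t → SternShaped c (suc (2 * N)) (step R t)
step-R-sternShaped c N t s =
  subst₂ (λ u v → Shaped u v (step R t))
         (sym (c*d-odd c N))
         (cong (c *_) (sym (trans (cong d (sym (*-suc 2 N))) (d-even (suc N)))))
         (step-R-shaped t s)

-- The length of S (suc p) when |A| = |B| = c.
markovLength : ℕ → ℕ → ℕ
markovLength c p = c * d p + c * d (suc p)

LengthsFrom : (ℕ → ℕ) → ℕ → List (List ℕ) → Set
LengthsFrom ℓ s []       = ⊤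
LengthsFrom ℓ s (x ∷ xs) = length x ≡ ℓ s × LengthsFrom ℓ (suc s) xs

LengthsFrom-++ : ∀ ℓ s xs {ys} → LengthsFrom ℓ s xs → LengthsFrom ℓ (s + length xs) ys →
                 LengthsFrom ℓ s (xs ++ ys)
LengthsFrom-++ ℓ s []       {ys} _         h = subst (λ s′ → LengthsFrom ℓ s′ ys) (+-identityʳ s) h
LengthsFrom-++ ℓ s (x ∷ xs) {ys} (∣x∣ , h) h′ =
  ∣x∣ , LengthsFrom-++ ℓ (suc s) xs h (subst (λ s′ → LengthsFrom ℓ s′ ys) (+-suc s (length xs)) h′)

LengthsFrom-lookupD : ∀ ℓ s xs {p} → LengthsFrom ℓ s xs → p < length xs →
                      length (lookupD [] xs p) ≡ ℓ (s + p)
LengthsFrom-lookupD ℓ s (x ∷ xs) {zero}  (∣x∣ , _) _ = trans ∣x∣ (cong ℓ (sym (+-identityʳ s)))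
LengthsFrom-lookupD ℓ s (x ∷ xs) {suc p} (_ , h) (s≤s p<∣xs∣) =
  trans (LengthsFrom-lookupD ℓ (suc s) xs h p<∣xs∣) (cong ℓ (sym (+-suc s p)))

length-words : ∀ m → length (words m) ≡ 2 ^ m
length-words zero    = refl
length-words (suc m) = begin
  length (map (L ∷_) (words m) ++ map (R ∷_) (words m))
    ≡⟨ length-++ (map (L ∷_) (words m)) ⟩
  length (map (L ∷_) (words m)) + length (map (R ∷_) (words m))
    ≡⟨ cong₂ _+_ (trans (length-map (L ∷_) (words m)) (length-words m))
                 (trans (length-map (R ∷_) (words m)) (length-words m)) ⟩
  2 ^ m + 2 ^ m
    ≡⟨ cong (2 ^ m +_) (sym (+-identityʳ (2 ^ m))) ⟩
  2 ^ suc m ∎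
  where open ≡-Reasoning

length-middlesAt : ∀ t m → length (middlesAt t m) ≡ 2 ^ m
length-middlesAt t m = trans (length-map _ (words m)) (length-words m)

middlesAt-suc : ∀ t m → middlesAt t (suc m) ≡ middlesAt (step L t) m ++ middlesAt (step R t) m
middlesAt-suc t m =
  trans (map-++ _ (map (L ∷_) (words m)) (map (R ∷_) (words m)))
        (cong₂ _++_ (sym (map-∘ (words m))) (sym (map-∘ (words m))))

*-double-swap : ∀ p N → p * (2 * N) ≡ 2 * p * N
*-double-swap p N = trans (sym (*-assoc p 2 N)) (cong (_* N) (*-comm p 2))

middlesAt-lengths : ∀ c m N t → SternShaped c N t →
                    LengthsFrom (markovLength c) (2 ^ m * N) (middlesAt t m)
middlesAt-lengths c zero N (x , y , z) (_ , ∣y∣ , _) =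
  trans ∣y∣ (cong (markovLength c) (sym (*-identityˡ N))) , tt
middlesAt-lengths c (suc m) N t s =
  subst (LengthsFrom ℓ (2 ^ suc m * N)) (sym (middlesAt-suc t m))
    (LengthsFrom-++ ℓ _ (middlesAt (step L t) m)
      (subst (λ o → LengthsFrom ℓ o (middlesAt (step L t) m)) (*-double-swap (2 ^ m) N)
             (middlesAt-lengths c m (2 * N) (step L t) (step-L-sternShaped c N t s)))
      (subst (λ o → LengthsFrom ℓ o (middlesAt (step R t) m)) offset-R
             (middlesAt-lengths c m (suc (2 * N)) (step R t) (step-R-sternShaped c N t s))))
  where
  ℓ = markovLength c
  offset-R : 2 ^ m * suc (2 * N) ≡ 2 ^ suc m * N + length (middlesAt (step L t) m)
  offset-R = begin
    2 ^ m * suc (2 * N)       ≡⟨ *-suc (2 ^ m) (2 * N) ⟩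
    2 ^ m + 2 ^ m * (2 * N)
      ≡⟨ cong₂ _+_ (sym (length-middlesAt (step L t) m)) (*-double-swap (2 ^ m) N) ⟩
    length (middlesAt (step L t) m) + 2 ^ suc m * N
      ≡⟨ +-comm _ (2 ^ suc m * N) ⟩
    2 ^ suc m * N + length (middlesAt (step L t) m) ∎
    where open ≡-Reasoning

length-middlesUpTo : ∀ t n → 2 + length (middlesUpTo t n) ≡ 2 ^ suc n
length-middlesUpTo t zero    = refl
length-middlesUpTo t (suc n) = begin
  2 + length (middlesUpTo t n ++ middlesAt t (suc n))
    ≡⟨ cong (2 +_) (trans (length-++ (middlesUpTo t n))
                          (cong (length (middlesUpTo t n) +_) (length-middlesAt t (suc n)))) ⟩
  2 + (length (middlesUpTo t n) + 2 ^ suc n)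
    ≡⟨ sym (+-assoc 2 (length (middlesUpTo t n)) (2 ^ suc n)) ⟩
  2 + length (middlesUpTo t n) + 2 ^ suc n
    ≡⟨ cong₂ _+_ (length-middlesUpTo t n) (sym (+-identityʳ (2 ^ suc n))) ⟩
  2 ^ suc (suc n) ∎
  where open ≡-Reasoning

middlesUpTo-lengths : ∀ c t n → SternShaped c 1 t → LengthsFrom (markovLength c) 2 (middlesUpTo t n)
middlesUpTo-lengths c t zero    _ = tt
middlesUpTo-lengths c t (suc n) s =
  LengthsFrom-++ (markovLength c) 2 (middlesUpTo t n) (middlesUpTo-lengths c t n s)
    (subst (λ o → LengthsFrom (markovLength c) o (middlesAt t (suc n)))
           (trans (*-identityʳ (2 ^ suc n)) (sym (length-middlesUpTo t n)))
           (middlesAt-lengths c (suc n) 1 t s))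

n<2^n : ∀ n → n < 2 ^ n
n<2^n zero    = s≤s z≤n
n<2^n (suc n) = begin-strict
  suc n          ≡⟨ +-comm 1 n ⟩
  n + 1          <⟨ +-mono-<-≤ (n<2^n n) (m^n>0 2 n) ⟩
  2 ^ n + 2 ^ n  ≡⟨ cong (2 ^ n +_) (sym (+-identityʳ (2 ^ n))) ⟩
  2 ^ suc n      ∎
  where open ≤-Reasoning

length-S : ∀ c A B → length A ≡ c → length B ≡ c →
           ∀ q → 0 < q → length (S A B q) ≡ c * d (2 * q ∸ 1)
length-S c A B ∣A∣ ∣B∣ (suc p) _ = begin
  length (lookupD [] rest p)  ≡⟨ LengthsFrom-lookupD (markovLength c) 0 rest rest-lengths p<∣rest∣ ⟩
  markovLength c p            ≡⟨ sym (c*d-odd c p) ⟩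
  c * d (suc (2 * p))         ≡⟨ cong (λ n → c * d (n ∸ 1)) (sym (*-suc 2 p)) ⟩
  c * d (2 * suc p ∸ 1)       ∎
  where
  open ≡-Reasoning
  v = (A , A ++ B , B)
  rest = B ∷ (A ++ B) ∷ middlesUpTo v (suc p)
  v-shaped : SternShaped c 1 v
  v-shaped = subst₂ (λ u w → Shaped u w v) (sym (*-identityʳ c)) (sym (*-identityʳ c))
                    (∣A∣ , trans (length-++ A) (cong₂ _+_ ∣A∣ ∣B∣) , ∣B∣)
  rest-lengths : LengthsFrom (markovLength c) 0 rest
  rest-lengths = trans (proj₂ (proj₂ v-shaped)) (cong (_+ c * 1) (sym (*-zeroʳ c)))
               , proj₁ (proj₂ v-shaped)
               , middlesUpTo-lengths c v (suc p) v-shaped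
  p<∣rest∣ : p < length rest
  p<∣rest∣ = ≤-<-trans (m≤n+m p 2)
               (subst (2 + p <_) (sym (length-middlesUpTo v (suc p))) (n<2^n (2 + p)))

pred-halving : ∀ x y → 2 * x ≡ y + 1 → y ∸ 1 ≡ 2 * (x ∸ 1)
pred-halving zero    y 0≡y+1 = ⊥-elim (0≢1+n (trans 0≡y+1 (+-comm y 1)))
pred-halving (suc x) y 2x≡y+1 =
  cong (_∸ 1) (sym (suc-injective (trans (sym (*-suc 2 x)) (trans 2x≡y+1 (+-comm y 1)))))

d-pred-invariant : ∀ (κ : ℕ → ℕ) n → (∀ j → j < n → 2 * κ (suc j) ≡ κ j + 1) →
                   d (κ n ∸ 1) ≡ d (κ 0 ∸ 1)
d-pred-invariant κ zero    _       = refl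
d-pred-invariant κ (suc n) halving = begin
  d (κ (suc n) ∸ 1)        ≡⟨ sym (d-even (κ (suc n) ∸ 1)) ⟩
  d (2 * (κ (suc n) ∸ 1))  ≡⟨ cong d (sym (pred-halving (κ (suc n)) (κ n) (halving n ≤-refl))) ⟩
  d (κ n ∸ 1)              ≡⟨ d-pred-invariant κ n (λ j j<n → halving j (m<n⇒m<1+n j<n)) ⟩
  d (κ 0 ∸ 1)              ∎
  where open ≡-Reasoning

lemma2p13 : (a b : ℕ) → 0 < a → 0 < b →
    (k : ℕ) → 0 < k → k % 2 ≡ 1 →
    (i : ℕ) → 2 ≤ i →
    (κ : ℕ → ℕ) → κ 1 ≡ k →
    (∀ j → 2 ≤ j → j ≤ i → 0 < κ j × 2 * κ j ≡ κ (j ∸ 1) + 1) →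
    2 * κ (suc i) ≡ κ i →
    length (S (a ∷ a ∷ []) (b ∷ b ∷ []) (κ (suc i))) ≡ 2 * d (k ∸ 1)
lemma2p13 a b _ _ k _ _ (suc n) 2≤i κ κ₁≡k halving last-halving = begin
  length (S (a ∷ a ∷ []) (b ∷ b ∷ []) (κ (suc (suc n))))
    ≡⟨ length-S 2 (a ∷ a ∷ []) (b ∷ b ∷ []) refl refl (κ (suc (suc n)))
                (0<half (κ (suc (suc n))) last-halving 0<κᵢ) ⟩
  2 * d (2 * κ (suc (suc n)) ∸ 1)
    ≡⟨ cong (λ x → 2 * d (x ∸ 1)) last-halving ⟩
  2 * d (κ (suc n) ∸ 1)
    ≡⟨ cong (2 *_) (d-pred-invariant (κ ∘ suc) n
                      (λ j j<n → proj₂ (halving (2 + j) (s≤s (s≤s z≤n)) (s≤s j<n)))) ⟩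
  2 * d (κ 1 ∸ 1)
    ≡⟨ cong (λ x → 2 * d (x ∸ 1)) κ₁≡k ⟩
  2 * d (k ∸ 1) ∎
  where
  open ≡-Reasoning
  0<κᵢ : 0 < κ (suc n)
  0<κᵢ = proj₁ (halving (suc n) 2≤i ≤-refl)
  0<half : ∀ q {m} → 2 * q ≡ m → 0 < m → 0 < q
  0<half zero    refl ()
  0<half (suc q) _    _ = s≤s z≤n
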